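{- Let $G$ be a graph and $S\subseteq V(G)$. Any $S$-connecting system $(\mathcal{S},\mathcal{T})$ in $G$ satisfies $|\mathcal{S}|\le|S|-1$.
   Context: An $S$-connecting system in $G$ is a pair $(\mathcal{S},\mathcal{T})$ where $\mathcal{S}=\{S_1,\dots,S_m\}$ is a collection of subsets of $S$ and $\mathcal{T}$ is a tree such that: (1) $V(\mathcal{T})=S\cup\{u_1,\dots,u_m\}$ with $m=|\mathcal{S}|$; (2) for all $i\in[m]$, $S_i=N_{\mathcal{T}}(u_i)\subseteq S$ and $\deg_{\mathcal{T}}(u_i)>1$; (3) for all distinct $s,s'\in S$, if $\{s,s'\}\in E(\mathcal{T})$ then $\{s,s'\}\in E(G)$. -}

module Defs where

open import Level using (Level; _⊔_; suc)
open import Data.Nat using (ℕ; _≤_; _∸_; _≥_)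
open import Data.Fin using (Fin)
open import Data.Fin.Subset using (Subset; _∈_; ∣_∣)
open import Data.Sum using (_⊎_; inj₁; inj₂)
open import Data.Product using (Σ; Σ-syntax; ∃; ∃-syntax; _×_; _,_)
open import Data.List using (List; []; _∷_; length; last)
open import Data.List.Relation.Unary.Unique.Propositional using (Unique)
open import Data.Maybe using (just)
open import Relation.Nullary using (¬_)
open import Relation.Binary.PropositionalEquality using (_≡_)

record Graph (V : Set) : Set₁ where
  field
    Adj    : V → V → Set
    sym    : ∀ {x y} → Adj x y → Adj y x
    irrefl : ∀ {x} → ¬ Adj x x
open Graph public

data Walk {V : Set} (G : Graph V) : V → V → Set where
  here : ∀ {x} → Walk G x x
  step : ∀ {x y z} → Adj G x y → Walk G y z → Walk G x z

Connected : {V : Set} → Graph V → Set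
Connected G = ∀ x y → Walk G x y

data Chain {V : Set} (G : Graph V) : List V → Set where
  nil  : Chain G []
  one  : ∀ {x} → Chain G (x ∷ [])
  cons : ∀ {x y xs} → Adj G x y → Chain G (y ∷ xs) → Chain G (x ∷ y ∷ xs)

record Cycle {V : Set} (G : Graph V) : Set where
  field
    v₀     : V
    rest   : List V
    vk     : V
    len≥3  : length (v₀ ∷ rest) ≥ 3
    lastEq : last (v₀ ∷ rest) ≡ just vk
    distinct : Unique (v₀ ∷ rest)
    chain  : Chain G (v₀ ∷ rest)
    close  : Adj G vk v₀

Acyclic : {V : Set} → Graph V → Set
Acyclic G = ¬ Cycle G

IsTree : {V : Set} → Graph V → Set
IsTree G = Connected G × Acyclic G

Elem : {n : ℕ} → Subset n → Set
Elem {n} S = Σ (Fin n) (λ v → v ∈ S)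

-- An S-connecting system (𝒮, 𝒯) in G with m = |𝒮|.  The tree 𝒯 has vertex
-- set S ⊎ {u₁,…,u_m} (u_i = inj₂ i), and S_i is N_𝒯(u_i).
record ConnectingSystem {n : ℕ} (G : Graph (Fin n)) (S : Subset n) (m : ℕ) : Set₁ where
  field
    T      : Graph (Elem S ⊎ Fin m)
    isTree : IsTree T
    -- (2) N_𝒯(u_i) ⊆ S : no u_i is adjacent to some u_j
    nbrsInS : ∀ i j → ¬ Adj T (inj₂ i) (inj₂ j)
    deg>1  : ∀ i → ∃[ a ] ∃[ b ] (¬ a ≡ b × Adj T (inj₂ i) a × Adj T (inj₂ i) b)
    edgesInG : ∀ (s s' : Elem S) → Adj T (inj₁ s) (inj₁ s') →
               Adj G (Σ.proj₁ s) (Σ.proj₁ s')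

{-# OPTIONS --safe #-}
module Submission where

open import Defs hiding (sym)
open import Data.Nat using (ℕ; _≤_; _∸_)
open import Data.Fin using (Fin)
open import Data.Fin.Subset using (Subset; ∣_∣)

open import Data.Nat using (zero; suc; _+_; _<_; z≤n; s≤s)
open import Data.Nat.Properties using (+-suc; +-identityʳ; m≤n+m; m≤n⇒m≤1+n; ≤-refl; <⇒≤; <-irrefl)
open import Data.Fin using (toℕ; fromℕ<; punchOut) renaming (zero to fzero; suc to fsuc)
open import Data.Fin.Properties using (toℕ-fromℕ<; punchOut-injective; suc-injective; ¬Fin0)
  renaming (_≟_ to _≟ᶠ_)
open import Data.Fin.Subset using (_∈_; inside; outside)
open import Data.Vec using (_∷_; here; there)
open import Data.Vec.Properties.WithK using ([]=-irrelevant)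
open import Data.Sum using (_⊎_; inj₁; inj₂)
open import Data.Sum.Properties using () renaming (≡-dec to ⊎-≡-dec)
open import Data.Product using (∃₂; _×_; _,_; proj₁; proj₂)
open import Data.Product.Properties using (Σ-≡,≡→≡) renaming (≡-dec to Σ-≡-dec)
open import Data.List using (List; []; _∷_; last)
open import Data.List.Relation.Unary.All using (All; []; _∷_)
open import Data.List.Relation.Unary.All.Properties using (¬Any⇒All¬)
open import Data.List.Relation.Unary.Any using (Any; here; there; any?)
open import Data.List.Relation.Unary.AllPairs using ([]; _∷_)
open import Data.List.Relation.Unary.Unique.Propositional using (Unique)
open import Data.Maybe using (just)
open import Data.Unit using (⊤; tt)
open import Data.Empty using (⊥-elim)
open import Function using (_∘_)
open import Level using (0ℓ)
open import Relation.Nullary using (¬_; yes; no)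
open import Relation.Binary using (Rel; Symmetric; Transitive; _⇒_; DecidableEquality)
open import Relation.Binary.PropositionalEquality using (_≡_; _≢_; refl; sym; trans; subst; cong)

-- Process u₀, …, u_{m-1} in turn, keeping a labelling of S by p colours with
-- p + j = |S| in which equally coloured vertices are joined in 𝒯 through
-- S ∪ {u_i : i < j}.  The two distinct S-neighbours of u_j have different
-- colours, since a walk between them avoiding u_j would close a cycle
-- through u_j; so merging their colours costs exactly one colour.  At the
-- end p + m = |S|, and p ≥ 1 as soon as m ≥ 1 because then S ≠ ∅.

data WalkIn {V : Set} (H : Graph V) (P : V → Set) : V → V → Set where
  [_]    : ∀ {x} → P x → WalkIn H P x x
  _∷⟨_⟩_ : ∀ {x y z} → P x → Adj H x y → WalkIn H P y z → WalkIn H P x z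

module _ {V : Set} {H : Graph V} where

  start : ∀ {P x y} → WalkIn H P x y → P x
  start [ px ]         = px
  start (px ∷⟨ _ ⟩ _) = px

  _++ʷ_ : ∀ {P x y z} → WalkIn H P x y → WalkIn H P y z → WalkIn H P x z
  [ _ ]         ++ʷ w′ = w′
  (px ∷⟨ e ⟩ w) ++ʷ w′ = px ∷⟨ e ⟩ (w ++ʷ w′)

  reverseʷ : ∀ {P x y} → WalkIn H P x y → WalkIn H P y x
  reverseʷ [ px ]         = [ px ]
  reverseʷ (px ∷⟨ e ⟩ w) = reverseʷ w ++ʷ (start w ∷⟨ Graph.sym H e ⟩ [ px ])

  mapʷ : ∀ {P Q : V → Set} {x y} → (∀ {v} → P v → Q v) → WalkIn H P x y → WalkIn H Q x y
  mapʷ f [ px ]         = [ f px ]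
  mapʷ f (px ∷⟨ e ⟩ w) = f px ∷⟨ e ⟩ mapʷ f w

record PathIn {V : Set} (H : Graph V) (P : V → Set) (x z : V) : Set where
  constructor path
  field
    inner  : List V
    unique : Unique (x ∷ inner)
    chain  : Chain H (x ∷ inner)
    ends   : last (x ∷ inner) ≡ just z
    within : All P (x ∷ inner)

module _ {V : Set} {H : Graph V} (_≟_ : DecidableEquality V) where

  shortcut : ∀ {P x y z} (π : PathIn H P y z) → Any (x ≡_) (y ∷ PathIn.inner π) → PathIn H P x z
  shortcut π (here refl) = π
  shortcut (path (_ ∷ r) (_ ∷ u) (cons _ ch) l (_ ∷ a)) (there x∈r) = shortcut (path r u ch l a) x∈r

  walk⇒path : ∀ {P x z} → WalkIn H P x z → PathIn H P x z
  walk⇒path [ px ] = path [] ([] ∷ []) one refl (px ∷ [])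
  walk⇒path {x = x} (_∷⟨_⟩_ {y = y} px e w) with walk⇒path w
  ... | π@(path r u ch l a) with any? (x ≟_) (y ∷ r)
  ... | yes x∈ = shortcut π x∈
  ... | no x∉ = path (y ∷ r) (¬Any⇒All¬ _ x∉ ∷ u) (cons e ch) l (px ∷ a)

  acyclic⇒neighbours-separated : ∀ {v x y} → Acyclic H → x ≢ y →
    Adj H v x → Adj H v y → ¬ WalkIn H (v ≢_) x y
  acyclic⇒neighbours-separated {v} {x} {y} acyclic x≢y vx vy w with walk⇒path w
  ... | path [] _ _ refl _ = x≢y refl
  ... | path (x′ ∷ r) u ch l a = acyclic record
    { v₀ = v ; rest = x ∷ x′ ∷ r ; vk = y
    ; len≥3 = s≤s (s≤s (s≤s z≤n)) ; lastEq = l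
    ; distinct = a ∷ u ; chain = cons vx ch ; close = Graph.sym H vy }

rank : ∀ {n} (S : Subset n) {x} → x ∈ S → Fin ∣ S ∣
rank (inside  ∷ S) here        = fzero
rank (inside  ∷ S) (there x∈S) = fsuc (rank S x∈S)
rank (outside ∷ S) (there x∈S) = rank S x∈S

rank-injective : ∀ {n} (S : Subset n) {x y} (x∈S : x ∈ S) (y∈S : y ∈ S) →
  rank S x∈S ≡ rank S y∈S → x ≡ y
rank-injective (inside ∷ S) here here _ = refl
rank-injective (inside ∷ S) (there x∈S) (there y∈S) e =
  cong fsuc (rank-injective S x∈S y∈S (suc-injective e))
rank-injective (outside ∷ S) (there x∈S) (there y∈S) e =
  cong fsuc (rank-injective S x∈S y∈S e)

Elem-≡ : ∀ {n} {S : Subset n} {a b : Elem S} → proj₁ a ≡ proj₁ b → a ≡ b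
Elem-≡ refl = Σ-≡,≡→≡ (refl , []=-irrelevant _ _)

Elem-≟ : ∀ {n} {S : Subset n} → DecidableEquality (Elem S)
Elem-≟ = Σ-≡-dec _≟ᶠ_ (λ p q → yes ([]=-irrelevant p q))

module _ {p : ℕ} (i j : Fin (suc p)) (i≢j : i ≢ j) where

  merge : Fin (suc p) → Fin p
  merge k with k ≟ᶠ j
  ... | yes _  = punchOut (i≢j ∘ sym)
  ... | no k≢j = punchOut (k≢j ∘ sym)

  merge-fibre : ∀ k l → merge k ≡ merge l → k ≡ l ⊎ (k ≡ i ⊎ k ≡ j) × (l ≡ i ⊎ l ≡ j)
  merge-fibre k l e with k ≟ᶠ j | l ≟ᶠ j
  ... | yes k≡j | yes l≡j = inj₁ (trans k≡j (sym l≡j))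
  ... | yes k≡j | no l≢j  = inj₂ (inj₂ k≡j , inj₁ (sym (punchOut-injective (i≢j ∘ sym) (l≢j ∘ sym) e)))
  ... | no k≢j  | yes l≡j = inj₂ (inj₁ (punchOut-injective (k≢j ∘ sym) (i≢j ∘ sym) e) , inj₂ l≡j)
  ... | no k≢j  | no l≢j  = inj₁ (punchOut-injective (k≢j ∘ sym) (l≢j ∘ sym) e)

record Labelling {X : Set} (R : Rel X 0ℓ) (p : ℕ) : Set where
  field
    label : X → Fin p
    sound : ∀ {x y} → label x ≡ label y → R x y
open Labelling

module _ {X : Set} {R : Rel X 0ℓ} where

  Labelling-mono : ∀ {R′ p} → R ⇒ R′ → Labelling R p → Labelling R′ p
  Labelling-mono R⇒R′ ℓ = record { label = label ℓ ; sound = R⇒R′ ∘ sound ℓ }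

  Labelling-merge : ∀ {p a b} → Symmetric R → Transitive R → R a b →
    (ℓ : Labelling R (suc p)) → label ℓ a ≢ label ℓ b → Labelling R p
  Labelling-merge {a = a} {b} R-sym R-trans Rab ℓ a≢b = record
    { label = merge (label ℓ a) (label ℓ b) a≢b ∘ label ℓ ; sound = sound′ }
    where
      toward-a : ∀ {x} → label ℓ x ≡ label ℓ a ⊎ label ℓ x ≡ label ℓ b → R x a
      toward-a (inj₁ xa) = sound ℓ xa
      toward-a (inj₂ xb) = R-trans (sound ℓ xb) (R-sym Rab)

      sound′ : ∀ {x y} → merge _ _ a≢b (label ℓ x) ≡ merge _ _ a≢b (label ℓ y) → R x y
      sound′ {x} {y} e with merge-fibre _ _ a≢b (label ℓ x) (label ℓ y) e
      ... | inj₁ xy        = sound ℓ xy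
      ... | inj₂ (xab , yab) = R-trans (toward-a xab) (R-sym (toward-a yab))

m≤p+m∸1 : ∀ {p m} → (Fin m → Fin p) → m ≤ p + m ∸ 1
m≤p+m∸1 {m = zero}          _ = z≤n
m≤p+m∸1 {p = zero} {suc m}  f = ⊥-elim (¬Fin0 (f fzero))
m≤p+m∸1 {p = suc p} {suc m} _ = m≤n+m (suc m) p

module _ {n} {G : Graph (Fin n)} {S : Subset n} {m} (CS : ConnectingSystem G S m) where
  open ConnectingSystem CS

  Vertex : Set
  Vertex = Elem S ⊎ Fin m

  Within : ℕ → Vertex → Set
  Within j (inj₁ _) = ⊤
  Within j (inj₂ i) = toℕ i < j

  Linked : ℕ → Rel (Elem S) 0ℓ
  Linked j a b = WalkIn T (Within j) (inj₁ a) (inj₁ b)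

  S-neighbours : ∀ i → ∃₂ λ a b → a ≢ b × Adj T (inj₂ i) (inj₁ a) × Adj T (inj₂ i) (inj₁ b)
  S-neighbours i with deg>1 i
  ... | inj₂ k , _ , _ , ik , _ = ⊥-elim (nbrsInS i k ik)
  ... | inj₁ _ , inj₂ k , _ , _ , ik = ⊥-elim (nbrsInS i k ik)
  ... | inj₁ a , inj₁ b , a≢b , ia , ib = a , b , a≢b ∘ cong inj₁ , ia , ib

  linked-through : ∀ {j a b} (i : Fin m) → toℕ i ≡ j →
    Adj T (inj₂ i) (inj₁ a) → Adj T (inj₂ i) (inj₁ b) → Linked (suc j) a b
  linked-through i refl ia ib = tt ∷⟨ Graph.sym T ia ⟩ (≤-refl ∷⟨ ib ⟩ [ tt ])

  unlinked-before : ∀ {j a b} (i : Fin m) → toℕ i ≡ j → a ≢ b →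
    Adj T (inj₂ i) (inj₁ a) → Adj T (inj₂ i) (inj₁ b) → ¬ Linked j a b
  unlinked-before i refl a≢b ia ib w =
    acyclic⇒neighbours-separated (⊎-≡-dec Elem-≟ _≟ᶠ_) (proj₂ isTree)
      (a≢b ∘ Elem-injective) ia ib (mapʷ avoids-u w)
    where
      Elem-injective : ∀ {a b : Elem S} → inj₁ {B = Fin m} a ≡ inj₁ b → a ≡ b
      Elem-injective refl = refl
      avoids-u : ∀ {v} → Within (toℕ i) v → inj₂ i ≢ v
      avoids-u i<i refl = <-irrefl refl i<i

  Linked-sym : ∀ {j} → Symmetric (Linked j)
  Linked-sym = reverseʷ

  Linked-trans : ∀ {j} → Transitive (Linked j)
  Linked-trans = _++ʷ_

  Linked-mono : ∀ {j} → Linked j ⇒ Linked (suc j)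
  Linked-mono = mapʷ widen
    where
      widen : ∀ {j v} → Within j v → Within (suc j) v
      widen {v = inj₁ _} _   = tt
      widen {v = inj₂ _} i<j = m≤n⇒m≤1+n i<j

  initial : Labelling (Linked 0) ∣ S ∣
  initial = record
    { label = λ (_ , x∈S) → rank S x∈S
    ; sound = λ {(_ , x∈S)} {(_ , y∈S)} e → subst (Linked 0 _) (Elem-≡ (rank-injective S x∈S y∈S e)) [ tt ] }

  labelling : ∀ j → j ≤ m → ∃₂ λ p (_ : p + j ≡ ∣ S ∣) → Labelling (Linked j) p
  labelling zero    _   = ∣ S ∣ , +-identityʳ _ , initial
  labelling (suc j) j<m with labelling j (<⇒≤ j<m) | S-neighbours (fromℕ< j<m)
  ... | zero  , _   , ℓ | a , _ = ⊥-elim (¬Fin0 (label ℓ a))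
  ... | suc p , eqn , ℓ | a , b , a≢b , ia , ib =
    p , trans (+-suc p j) eqn ,
    Labelling-merge Linked-sym Linked-trans (linked-through i i≡j ia ib)
      (Labelling-mono Linked-mono ℓ) (unlinked-before i i≡j a≢b ia ib ∘ sound ℓ)
    where
      i = fromℕ< j<m
      i≡j = toℕ-fromℕ< j<m

lemma6 : {n : ℕ} (G : Graph (Fin n)) (S : Subset n) (m : ℕ) →
    ConnectingSystem G S m → m ≤ ∣ S ∣ ∸ 1
lemma6 G S m CS with labelling CS m ≤-refl
... | p , p+m≡∣S∣ , ℓ =
  subst (λ s → m ≤ s ∸ 1) p+m≡∣S∣ (m≤p+m∸1 (label ℓ ∘ proj₁ ∘ S-neighbours CS))
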